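{- Let $Q$ be a finite alphabet with $|Q|\ge 2$, let $Z$ be a countable set, and let $f:Q^Z\to Q^Z$ be a network. Then: (i) $f$ satisfies (C1) $\iff$ $f$ satisfies (C1a) $\iff$ $f$ satisfies (C1b); (ii) $f$ satisfies (C2) $\iff$ $f$ satisfies (C2a) $\iff$ $f$ satisfies (C2b); (iii) $f$ satisfies (C3) $\iff$ $f$ satisfies (C3a) $\iff$ $f$ satisfies (C3b); (iv) $f$ satisfies (C1) $\iff$ $f$ satisfies (C2). Moreover, there exist a finite alphabet $Q$ with $|Q|\ge2$, a countable set $Z$ and a network $f:Q^Z\to Q^Z$ which satisfies (C1) but does not satisfy (C3).
   Context: A network is any map $f:Q^Z\to Q^Z$, with coordinate functions $f_i:Q^Z\to Q$ ($i\in Z$). For $x\in Q^Z$ and $s\subseteq Z$ write $x_s=(x_i)_{i\in s}$, $f_s=(f_i)_{i\in s}$, and $(x_s,y_{Z\setminus s})$ for the configuration equal to $x$ on $s$ and to $y$ on $Z\setminus s$. For $s\subseteq Z$, the update of $s$ is $f^{(s)}:Q^Z\to Q^Z$, $f^{(s)}(x)=(f_s(x),x_{Z\setminus s})$; for a finite sequence $s_1,\dots,s_k$ of subsets, $f^{(s_1,\dots,s_k)}=f^{(s_k)}\circ\cdots\circ f^{(s_1)}$; for $i\in Z$, $f^{(i)}=f^{(\{i\})}$. Commutativity properties: (C1) $f^{(i,j)}=f^{(j,i)}$ for all $i,j\in Z$; (C2) $f^{(b,c)}=f^{(c,b)}$ for all finite $b,c\subseteq Z$; (C3) $f^{(s,t)}=f^{(t,s)}$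 for all $s,t\subseteq Z$. An enumeration of $Z$ is a sequence $Y=(y_\tau:\tau\in\mathbb{N})$ ($\mathbb N=\{1,2,\dots\}$) of pairwise disjoint subsets of $Z$ (possibly empty) with $\bigcup_\tau y_\tau=Z$. It is sequential if each $y_\tau$ is a singleton or empty, and finite-block if each $y_\tau$ is finite. Write $Y_t=(y_1,\dots,y_t)$, and define $f^Y:Q^Z\to Q^Z$ by $f^Y_{y_\tau}:=f^{(y_1,\dots,y_\tau)}_{y_\tau}$ for all $\tau\in\mathbb{N}$. (C1a) $f^I=f^J$ for any two sequential enumerations $I,J$ of $Z$; (C2a) $f^B=f^C$ for any two finite-block enumerations $B,C$ of $Z$; (C3a) $f^S=f^T$ for any two enumerations $S,T$ of $Z$. (C1b) $f=f^I$ for every sequential enumeration $I$ of $Z$; (C2b) $f=f^B$ for every finite-block enumeration $B$ of $Z$; (C3b) $f=f^S$ for every enumeration $S$ of $Z$. -}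

module Defs where

open import Level using (0ℓ)
open import Data.Nat using (ℕ; zero; suc; _≤_)
import Data.Nat as ℕ
open import Data.Fin using (Fin)
open import Data.Bool using (Bool; true; false; if_then_else_)
open import Data.List using (List; []; _∷_; applyUpTo)
open import Data.List.Membership.Propositional using (_∈_)
open import Data.Product using (Σ; _×_; _,_; proj₁)
open import Data.Sum using (_⊎_)
open import Relation.Binary.PropositionalEquality using (_≡_; cong)
open import Relation.Binary.Definitions using (DecidableEquality)
open import Relation.Nullary using (¬_; does)
open import Relation.Nullary.Decidable using (map′)
open import Function.Bundles using (_↔_; _↣_; Injection)

FiniteAlphabet : Set → Set
FiniteAlphabet Q = Σ ℕ λ n → (2 ≤ n) × (Fin n ↔ Q)

Countable : Set → Set
Countable Z = Z ↣ ℕ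

decEq : {Z : Set} → Countable Z → DecidableEquality Z
decEq inj z w = map′ (Injection.injective inj) (cong (Injection.to inj))
                     (Injection.to inj z ℕ.≟ Injection.to inj w)

Subset : Set → Set
Subset Z = Z → Bool

Finite : {Z : Set} → Subset Z → Set
Finite {Z} s = Σ (List Z) λ l → ∀ z → s z ≡ true → z ∈ l

_≈_ : {Q Z : Set} → ((Z → Q) → (Z → Q)) → ((Z → Q) → (Z → Q)) → Set
F ≈ G = ∀ x i → F x i ≡ G x i

-- f respects pointwise equality of configurations (automatic in set theory).
Extensional : {Q Z : Set} → ((Z → Q) → (Z → Q)) → Set
Extensional {Q} {Z} f = (x y : Z → Q) → (∀ i → x i ≡ y i) → ∀ i → f x i ≡ f y i

-- Enumerations of Z: blocks indexed by ℕ = {0,1,2,...} (block τ is y_{τ+1}).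
record Enumeration (Z : Set) : Set where
  field
    block    : ℕ → Subset Z
    disjoint : ∀ τ σ z → block τ z ≡ true → block σ z ≡ true → τ ≡ σ
    covers   : ∀ z → Σ ℕ λ τ → block τ z ≡ true
open Enumeration public

Sequential : {Z : Set} → Enumeration Z → Set
Sequential {Z} E = ∀ τ → (∀ z → block E τ z ≡ false)
                       ⊎ (Σ Z λ i → (block E τ i ≡ true) × (∀ z → block E τ z ≡ true → z ≡ i))

FiniteBlock : {Z : Set} → Enumeration Z → Set
FiniteBlock E = ∀ τ → Finite (block E τ)

module Network {Q Z : Set} (_≟_ : DecidableEquality Z) (f : (Z → Q) → (Z → Q)) where

  ⁅_⁆ : Z → Subset Z
  ⁅ i ⁆ z = does (z ≟ i)

  upd : Subset Z → (Z → Q) → (Z → Q)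
  upd s x i = if s i then f x i else x i

  updSeq : List (Subset Z) → (Z → Q) → (Z → Q)
  updSeq []       x = x
  updSeq (s ∷ ss) x = updSeq ss (upd s x)

  -- f^Y : on the block y_τ containing i, (f^Y x)_i = (f^(y_1,…,y_τ) x)_i
  fE : Enumeration Z → (Z → Q) → (Z → Q)
  fE E x i = updSeq (applyUpTo (block E) (suc (proj₁ (covers E i)))) x i

  C1 : Set
  C1 = ∀ i j → updSeq (⁅ i ⁆ ∷ ⁅ j ⁆ ∷ []) ≈ updSeq (⁅ j ⁆ ∷ ⁅ i ⁆ ∷ [])

  C2 : Set
  C2 = ∀ b c → Finite b → Finite c → updSeq (b ∷ c ∷ []) ≈ updSeq (c ∷ b ∷ [])

  C3 : Set
  C3 = ∀ s t → updSeq (s ∷ t ∷ []) ≈ updSeq (t ∷ s ∷ [])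

  C1a : Set
  C1a = ∀ I J → Sequential I → Sequential J → fE I ≈ fE J

  C2a : Set
  C2a = ∀ B C → FiniteBlock B → FiniteBlock C → fE B ≈ fE C

  C3a : Set
  C3a = ∀ S T → fE S ≈ fE T

  C1b : Set
  C1b = ∀ I → Sequential I → f ≈ fE I

  C2b : Set
  C2b = ∀ B → FiniteBlock B → f ≈ fE B

  C3b : Set
  C3b = ∀ S → f ≈ fE S

module Submission where

-- Call a set s ⊆ Z invariant (for the network f) if updating s does not
-- change f outside s:  f(f^(s)(x))_i = f(x)_i  whenever i ∉ s.  All the
-- properties of the theorem reduce to invariance of a class of sets:
--   * (C1), (C2), (C1a), (C2a) are each equivalent to invariance of every
--     singleton, which by induction gives invariance of every finite set;
--   * (C3), (C3a) are each equivalent to invariance of every set.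
-- If all sets of a class closed under removing a point are invariant, their
-- updates commute; if every block of an enumeration Y is invariant, f = f^Y.
-- Conversely, the enumerations (a, {i}, rest) and ({i}, a, rest) differ at i
-- exactly by f(f^(a)(x))_i versus f(x)_i; listing the rest one point at a
-- time (via the injection Z ↣ ℕ) makes them sequential when a is a
-- singleton, excluded middle deciding which of these blocks are empty.
-- Each of (i)-(iii) is then a cycle X ⇒ Xb ⇒ Xa ⇒ X, and (iv) passes through
-- singleton invariance.  The counterexample is the network on Bool^ℕ with
-- f(x)_0 = [x is eventually true] and f(x)_n = true for n > 0: no finite
-- change of x affects f, but updating all positive coordinates does.

open import Defs
open import Level using (0ℓ)
open import Data.Nat using (ℕ; zero; suc; _+_; _≤_; _<_; z<s; s<s)
import Data.Nat as ℕ
open import Data.Nat.Properties using (suc-injective; <⇒≢; +-assoc; ≤-trans; m≤n+m; m≤m+n; ≤-refl)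
open import Data.Bool using (Bool; true; false; if_then_else_)
open import Data.Bool.Properties using (¬-not)
open import Data.Fin.Properties using (2↔Bool)
open import Data.List using ([]; _∷_; applyUpTo)
open import Data.List.Membership.Propositional using (_∈_)
open import Data.List.Relation.Unary.Any using (here; there)
open import Data.Product using (Σ; _×_; _,_; proj₁; proj₂)
open import Data.Sum using (_⊎_; inj₁; inj₂)
open import Data.Empty using (⊥; ⊥-elim)
open import Data.Unit using (⊤; tt)
open import Relation.Nullary using (¬_; Dec; yes; no; does)
open import Relation.Nullary.Decidable using (dec-true; dec-false; does-⇔)
open import Relation.Binary.PropositionalEquality
  using (_≡_; _≢_; refl; sym; trans; cong; cong₂; module ≡-Reasoning)
open import Relation.Binary.Definitions using (DecidableEquality)
open import Function.Base using (_∘_)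
open import Function.Bundles using (_⇔_; mk⇔; _↣_; Injection)
open import Function.Definitions using (Injective)
open import Function.Construct.Identity using (↣-id)
open import Axiom.ExcludedMiddle using (ExcludedMiddle)

open ≡-Reasoning

does-true⇒ : {P : Set} (d : Dec P) → does d ≡ true → P
does-true⇒ (yes p) _ = p

true≢false : true ≢ false
true≢false ()

cycle : {A B C : Set} → (A → C) → (C → B) → (B → A) → (A ⇔ B) × (B ⇔ C)
cycle a⇒c c⇒b b⇒a = mk⇔ (c⇒b ∘ a⇒c) b⇒a , mk⇔ (a⇒c ∘ b⇒a) c⇒b

blocksAt : {Z : Set} → (Z → ℕ) → ℕ → Subset Z
blocksAt pos τ z = does (pos z ℕ.≟ τ)

byPosition : {Z : Set} → (Z → ℕ) → Enumeration Z
byPosition pos = record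
  { block    = blocksAt pos
  ; disjoint = λ τ σ z p q → trans (sym (does-true⇒ (pos z ℕ.≟ τ) p)) (does-true⇒ (pos z ℕ.≟ σ) q)
  ; covers   = λ z → pos z , dec-true (pos z ℕ.≟ pos z) refl
  }

-- An injective position function gives blocks with at most one point;
-- excluded middle decides whether such a block is empty or a singleton.
byPosition-sequential : {Z : Set} {pos : Z → ℕ} → ExcludedMiddle 0ℓ →
                        Injective _≡_ _≡_ pos → Sequential (byPosition pos)
byPosition-sequential {Z} {pos} lem pos-inj τ with lem {Σ Z λ z → pos z ≡ τ}
... | yes (z , pz≡τ) = inj₂ (z , dec-true (pos z ℕ.≟ τ) pz≡τ ,
                             λ w q → pos-inj (trans (does-true⇒ (pos w ℕ.≟ τ) q) (sym pz≡τ)))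
... | no empty = inj₁ (λ w → dec-false (pos w ℕ.≟ τ) (λ pw≡τ → empty (w , pw≡τ)))

rank : Bool → Bool → ℕ → ℕ
rank true  _     _ = 0
rank false true  _ = 1
rank false false n = 2 + n

rank-first : ∀ p q n → does (rank p q n ℕ.≟ 0) ≡ p
rank-first true  _     _ = refl
rank-first false true  _ = refl
rank-first false false _ = refl

rank-inv : ∀ p q n p′ q′ n′ → rank p q n ≡ rank p′ q′ n′ →
           (p ≡ true × p′ ≡ true) ⊎ (q ≡ true × q′ ≡ true) ⊎ n ≡ n′
rank-inv true  _     _ true  _     _  _ = inj₁ (refl , refl)
rank-inv false true  _ false true  _  _ = inj₂ (inj₁ (refl , refl))
rank-inv false false n false false n′ e = inj₂ (inj₂ (suc-injective (suc-injective e)))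
rank-inv true  _     _ false true  _  ()
rank-inv true  _     _ false false _  ()
rank-inv false true  _ true  _     _  ()
rank-inv false true  _ false false _  ()
rank-inv false false _ true  _     _  ()
rank-inv false false _ false true  _  ()

leadingPos : {Z : Set} → (Z → ℕ) → Subset Z → Subset Z → Z → ℕ
leadingPos code a b z = rank (a z) (b z) (code z)

leading : {Z : Set} → (Z → ℕ) → Subset Z → Subset Z → Enumeration Z
leading code a b = byPosition (leadingPos code a b)

Subsingleton : {Z : Set} → Subset Z → Set
Subsingleton s = ∀ {z w} → s z ≡ true → s w ≡ true → z ≡ w

leadingPos-injective : {Z : Set} {code : Z → ℕ} {a b : Subset Z} →
                       Injective _≡_ _≡_ code → Subsingleton a → Subsingleton b →
                       Injective _≡_ _≡_ (leadingPos code a b)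
leadingPos-injective {code = code} {a} {b} code-inj a-sub b-sub {z} {w} e
  with rank-inv (a z) (b z) (code z) (a w) (b w) (code w) e
... | inj₁ (az , aw)        = a-sub az aw
... | inj₂ (inj₁ (bz , bw)) = b-sub bz bw
... | inj₂ (inj₂ same)      = code-inj same

module Invariance {Q Z : Set} (_≟_ : DecidableEquality Z)
                  (f : (Z → Q) → (Z → Q)) (ext : Extensional f) where
  open Network _≟_ f

  by-point : {P : Set} → ∀ z j → (z ≡ j → P) → (z ≢ j → P) → P
  by-point z j same other with z ≟ j
  ... | yes z≡j = same z≡j
  ... | no z≢j  = other z≢j

  ⁅⁆-self : ∀ {i} → ⁅ i ⁆ i ≡ true
  ⁅⁆-self {i} = dec-true (i ≟ i) refl

  ⁅⁆-other : ∀ {i z} → z ≢ i → ⁅ i ⁆ z ≡ false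
  ⁅⁆-other {i} {z} = dec-false (z ≟ i)

  ⁅⁆-subsingleton : ∀ {i} → Subsingleton ⁅ i ⁆
  ⁅⁆-subsingleton {i} {z} {w} p q = trans (does-true⇒ (z ≟ i) p) (sym (does-true⇒ (w ≟ i) q))

  ⁅⁆-finite : ∀ i → Finite ⁅ i ⁆
  ⁅⁆-finite i = i ∷ [] , λ z p → here (⁅⁆-subsingleton p ⁅⁆-self)

  distinct : ∀ {s : Subset Z} {i j} → s i ≡ false → s j ≡ true → i ≢ j
  distinct si sj refl = true≢false (trans (sym sj) si)

  _∖_ : Subset Z → Z → Subset Z
  (s ∖ k) z = if does (z ≟ k) then false else s z

  ∖-self : ∀ s k → (s ∖ k) k ≡ false
  ∖-self s k = cong (λ b → if b then false else s k) (dec-true (k ≟ k) refl)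

  ∖-other : ∀ s {k z} → z ≢ k → (s ∖ k) z ≡ s z
  ∖-other s {k} {z} z≢k = cong (λ b → if b then false else s z) (dec-false (z ≟ k) z≢k)

  ∖-⊆ : ∀ s k {z} → (s ∖ k) z ≡ true → s z ≡ true
  ∖-⊆ s k {z} q with z ≟ k
  ... | yes refl = ⊥-elim (true≢false (sym q))
  ... | no _     = q

  ∖-finite : ∀ s k → Finite s → Finite (s ∖ k)
  ∖-finite s k (l , s⊆l) = l , λ z q → s⊆l z (∖-⊆ s k q)

  upd-in : ∀ s x i → s i ≡ true → upd s x i ≡ f x i
  upd-in s x i si = cong (λ b → if b then f x i else x i) si

  upd-out : ∀ s x i → s i ≡ false → upd s x i ≡ x i
  upd-out s x i si = cong (λ b → if b then f x i else x i) si

  upd-cong : ∀ {s t} x → (∀ z → s z ≡ t z) → ∀ z → upd s x z ≡ upd t x z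
  upd-cong x s≗t z = cong (λ b → if b then f x z else x z) (s≗t z)

  Invariant : Subset Z → Set
  Invariant s = ∀ x i → s i ≡ false → f (upd s x) i ≡ f x i

  commuting⇒invariant : ∀ {s} →
    (∀ x i → s i ≡ false → updSeq (s ∷ ⁅ i ⁆ ∷ []) x i ≡ updSeq (⁅ i ⁆ ∷ s ∷ []) x i) →
    Invariant s
  commuting⇒invariant {s} comm x i si = begin
    f (upd s x) i             ≡⟨ sym (upd-in ⁅ i ⁆ (upd s x) i ⁅⁆-self) ⟩
    upd ⁅ i ⁆ (upd s x) i     ≡⟨ comm x i si ⟩
    upd s (upd ⁅ i ⁆ x) i     ≡⟨ upd-out s (upd ⁅ i ⁆ x) i si ⟩
    upd ⁅ i ⁆ x i             ≡⟨ upd-in ⁅ i ⁆ x i ⁅⁆-self ⟩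
    f x i                     ∎

  C1⇒singletons : C1 → ∀ j → Invariant ⁅ j ⁆
  C1⇒singletons c1 j = commuting⇒invariant (λ x i _ → c1 j i x i)

  C3⇒all : C3 → ∀ s → Invariant s
  C3⇒all c3 s = commuting⇒invariant (λ x i _ → c3 s ⁅ i ⁆ x i)

  empty-invariant : ∀ {s} → (∀ z → s z ≡ false) → Invariant s
  empty-invariant {s} empty x i _ = ext (upd s x) x (λ z → upd-out s x z (empty z)) i

  update-point-first : ∀ {s j} → Invariant ⁅ j ⁆ → s j ≡ true →
                       ∀ x z → upd s x z ≡ upd (s ∖ j) (upd ⁅ j ⁆ x) z
  update-point-first {s} {j} inv-j sj x z = by-point z j at-j off-j
    where
    at-j : z ≡ j → upd s x z ≡ upd (s ∖ j) (upd ⁅ j ⁆ x) z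
    at-j refl = begin
      upd s x j                   ≡⟨ upd-in s x j sj ⟩
      f x j                       ≡⟨ sym (upd-in ⁅ j ⁆ x j ⁅⁆-self) ⟩
      upd ⁅ j ⁆ x j               ≡⟨ sym (upd-out (s ∖ j) (upd ⁅ j ⁆ x) j (∖-self s j)) ⟩
      upd (s ∖ j) (upd ⁅ j ⁆ x) j ∎
    off-j : z ≢ j → upd s x z ≡ upd (s ∖ j) (upd ⁅ j ⁆ x) z
    off-j z≢j = begin
      upd s x z                                          ≡⟨ cong₂ (λ u v → if s z then u else v)
                                                              (sym (inv-j x z (⁅⁆-other z≢j)))
                                                              (sym (upd-out ⁅ j ⁆ x z (⁅⁆-other z≢j))) ⟩
      (if s z then f (upd ⁅ j ⁆ x) z else upd ⁅ j ⁆ x z) ≡⟨ sym (upd-cong (upd ⁅ j ⁆ x) (λ _ → ∖-other s z≢j) z) ⟩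
      upd (s ∖ j) (upd ⁅ j ⁆ x) z                        ∎

  insert-invariant : ∀ {s j} → Invariant ⁅ j ⁆ → s j ≡ true → Invariant (s ∖ j) → Invariant s
  insert-invariant {s} {j} inv-j sj inv-rest x i si = begin
    f (upd s x) i                   ≡⟨ ext _ _ (update-point-first inv-j sj x) i ⟩
    f (upd (s ∖ j) (upd ⁅ j ⁆ x)) i ≡⟨ inv-rest (upd ⁅ j ⁆ x) i (trans (∖-other s i≢j) si) ⟩
    f (upd ⁅ j ⁆ x) i               ≡⟨ inv-j x i (⁅⁆-other i≢j) ⟩
    f x i                           ∎
    where
    i≢j : i ≢ j
    i≢j = distinct si sj

  drop-head : ∀ (t : Subset Z) {j l} → t j ≡ false → (∀ z → t z ≡ true → z ∈ j ∷ l) →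
              ∀ z → t z ≡ true → z ∈ l
  drop-head t tj t⊆jl z q with t⊆jl z q
  ... | here refl = ⊥-elim (true≢false (trans (sym q) tj))
  ... | there z∈l = z∈l

  listed-invariant : (∀ j → Invariant ⁅ j ⁆) → ∀ l s → (∀ z → s z ≡ true → z ∈ l) → Invariant s
  listed-invariant inv-sing [] s s⊆[] = empty-invariant (λ z → ¬-not (λ q → absurd (s⊆[] z q)))
    where
    absurd : ∀ {z : Z} → z ∈ [] → ⊥
    absurd ()
  listed-invariant inv-sing (j ∷ l) s s⊆jl with s j in sj
  ... | false = listed-invariant inv-sing l s (drop-head s sj s⊆jl)
  ... | true  = insert-invariant {s} (inv-sing j) sj
                  (listed-invariant inv-sing l (s ∖ j)
                     (drop-head (s ∖ j) (∖-self s j) (λ z q → s⊆jl z (∖-⊆ s j q))))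

  finite-invariant : (∀ j → Invariant ⁅ j ⁆) → ∀ s → Finite s → Invariant s
  finite-invariant inv-sing s (l , s⊆l) = listed-invariant inv-sing l s s⊆l

  self-update : ∀ {s i} x → Invariant ⁅ i ⁆ → Invariant (s ∖ i) → s i ≡ true →
                f (upd s x) i ≡ f (upd ⁅ i ⁆ x) i
  self-update {s} {i} x inv-i inv-rest si =
    trans (ext _ _ (update-point-first inv-i si x) i) (inv-rest (upd ⁅ i ⁆ x) i (∖-self s i))

  commute-at : ∀ {s t} x i → Invariant ⁅ i ⁆ →
               Invariant s → Invariant (s ∖ i) → Invariant t → Invariant (t ∖ i) →
               updSeq (s ∷ t ∷ []) x i ≡ updSeq (t ∷ s ∷ []) x i
  commute-at {s} {t} x i inv-i inv-s inv-s∖i inv-t inv-t∖i with s i in si | t i in ti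
  ... | true  | true  = trans (self-update x inv-i inv-s∖i si) (sym (self-update x inv-i inv-t∖i ti))
  ... | true  | false = sym (inv-t x i ti)
  ... | false | true  = inv-s x i si
  ... | false | false = refl

  singletons⇒C2 : (∀ j → Invariant ⁅ j ⁆) → C2
  singletons⇒C2 inv-sing b c fin-b fin-c x i =
    commute-at x i (inv-sing i) (inv b fin-b) (inv (b ∖ i) (∖-finite b i fin-b))
                                (inv c fin-c) (inv (c ∖ i) (∖-finite c i fin-c))
    where
    inv : ∀ s → Finite s → Invariant s
    inv = finite-invariant inv-sing

  all⇒C3 : (∀ s → Invariant s) → C3
  all⇒C3 inv s t x i = commute-at x i (inv ⁅ i ⁆) (inv s) (inv (s ∖ i)) (inv t) (inv (t ∖ i))

  C2⇒C1 : C2 → C1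
  C2⇒C1 c2 i j = c2 ⁅ i ⁆ ⁅ j ⁆ (⁅⁆-finite i) (⁅⁆-finite j)

  singletons⇒C1 : (∀ j → Invariant ⁅ j ⁆) → C1
  singletons⇒C1 = C2⇒C1 ∘ singletons⇒C2

  first-hit : ∀ n (g : ℕ → Subset Z) x i → (∀ k → Invariant (g k)) →
              g n i ≡ true → (∀ k → k < n → g k i ≡ false) →
              updSeq (applyUpTo g (suc n)) x i ≡ f x i
  first-hit zero    g x i inv gn _      = upd-in (g 0) x i gn
  first-hit (suc n) g x i inv gn before =
    trans (first-hit n (g ∘ suc) (upd (g 0) x) i (inv ∘ suc) gn (λ k k<n → before (suc k) (s<s k<n)))
          (inv 0 x i (before 0 z<s))

  invariant-blocks⇒fE : ∀ E → (∀ τ → Invariant (block E τ)) → f ≈ fE E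
  invariant-blocks⇒fE E inv x i =
    sym (first-hit τ (block E) x i inv iτ (λ k k<τ → ¬-not (λ ik → <⇒≢ k<τ (disjoint E k τ i ik iτ))))
    where
    τ : ℕ
    τ = proj₁ (covers E i)
    iτ : block E τ i ≡ true
    iτ = proj₂ (covers E i)

  agree-via-f : (P : Enumeration Z → Set) → (∀ E → P E → f ≈ fE E) →
                ∀ E E′ → P E → P E′ → fE E ≈ fE E′
  agree-via-f P f≈ E E′ pE pE′ x i = trans (sym (f≈ E pE x i)) (f≈ E′ pE′ x i)

  sequential⇒finiteBlock : (E : Enumeration Z) → Sequential E → FiniteBlock E
  sequential⇒finiteBlock E seq τ with seq τ
  ... | inj₁ empty = [] , λ z p → ⊥-elim (true≢false (trans (sym p) (empty z)))
  ... | inj₂ (k , _ , only-k) = k ∷ [] , λ z p → here (only-k z p)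

  fE-leading-first : ∀ code a b x i → a i ≡ true → fE (leading code a b) x i ≡ f x i
  fE-leading-first code a b x i ai = begin
    fE (leading code a b) x i              ≡⟨ cong (λ τ → updSeq (applyUpTo bl (suc τ)) x i) pos≡0 ⟩
    upd (bl 0) x i                         ≡⟨ upd-in (bl 0) x i (dec-true (leadingPos code a b i ℕ.≟ 0) pos≡0) ⟩
    f x i                                  ∎
    where
    bl : ℕ → Subset Z
    bl = blocksAt (leadingPos code a b)
    pos≡0 : leadingPos code a b i ≡ 0
    pos≡0 = cong (λ p → rank p (b i) (code i)) ai

  fE-leading-second : ∀ code a b x i → a i ≡ false → b i ≡ true →
                      fE (leading code a b) x i ≡ f (upd a x) i
  fE-leading-second code a b x i ai bi = begin
    fE (leading code a b) x i              ≡⟨ cong (λ τ → updSeq (applyUpTo bl (suc τ)) x i) pos≡1 ⟩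
    upd (bl 1) (upd (bl 0) x) i            ≡⟨ upd-in (bl 1) (upd (bl 0) x) i (dec-true (leadingPos code a b i ℕ.≟ 1) pos≡1) ⟩
    f (upd (bl 0) x) i                     ≡⟨ ext _ _ (upd-cong x (λ z → rank-first (a z) (b z) (code z))) i ⟩
    f (upd a x) i                          ∎
    where
    bl : ℕ → Subset Z
    bl = blocksAt (leadingPos code a b)
    pos≡1 : leadingPos code a b i ≡ 1
    pos≡1 = cong₂ (λ p q → rank p q (code i)) ai bi

  leading-swap⇒invariant-at : ∀ code a x i → a i ≡ false →
    fE (leading code a ⁅ i ⁆) x i ≡ fE (leading code ⁅ i ⁆ a) x i →
    f (upd a x) i ≡ f x i
  leading-swap⇒invariant-at code a x i ai swap =
    trans (sym (fE-leading-second code a ⁅ i ⁆ x i ai ⁅⁆-self))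
          (trans swap (fE-leading-first code ⁅ i ⁆ a x i ⁅⁆-self))

  leading-sequential : ExcludedMiddle 0ℓ → (code : Z ↣ ℕ) → ∀ j i →
                       Sequential (leading (Injection.to code) ⁅ j ⁆ ⁅ i ⁆)
  leading-sequential lem code j i =
    byPosition-sequential lem (leadingPos-injective (Injection.injective code) ⁅⁆-subsingleton ⁅⁆-subsingleton)

  C1a⇒singletons : ExcludedMiddle 0ℓ → Z ↣ ℕ → C1a → ∀ j → Invariant ⁅ j ⁆
  C1a⇒singletons lem code c1a j x i ji = leading-swap⇒invariant-at enc ⁅ j ⁆ x i ji
    (c1a (leading enc ⁅ j ⁆ ⁅ i ⁆) (leading enc ⁅ i ⁆ ⁅ j ⁆)
         (leading-sequential lem code j i) (leading-sequential lem code i j) x i)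
    where
    enc : Z → ℕ
    enc = Injection.to code

  C2a⇒singletons : ExcludedMiddle 0ℓ → Z ↣ ℕ → C2a → ∀ j → Invariant ⁅ j ⁆
  C2a⇒singletons lem code c2a j x i ji = leading-swap⇒invariant-at enc ⁅ j ⁆ x i ji
    (c2a (leading enc ⁅ j ⁆ ⁅ i ⁆) (leading enc ⁅ i ⁆ ⁅ j ⁆) (finite j i) (finite i j) x i)
    where
    enc : Z → ℕ
    enc = Injection.to code
    finite : ∀ k l → FiniteBlock (leading enc ⁅ k ⁆ ⁅ l ⁆)
    finite k l = sequential⇒finiteBlock (leading enc ⁅ k ⁆ ⁅ l ⁆) (leading-sequential lem code k l)

  C3a⇒all : Z ↣ ℕ → C3a → ∀ s → Invariant s
  C3a⇒all code c3a s x i si = leading-swap⇒invariant-at enc s x i si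
    (c3a (leading enc s ⁅ i ⁆) (leading enc ⁅ i ⁆ s) x i)
    where
    enc : Z → ℕ
    enc = Injection.to code

  characterisation : ExcludedMiddle 0ℓ → Z ↣ ℕ →
    ((C1 ⇔ C1a) × (C1a ⇔ C1b)) × ((C2 ⇔ C2a) × (C2a ⇔ C2b)) × ((C3 ⇔ C3a) × (C3a ⇔ C3b)) × (C1 ⇔ C2)
  characterisation lem code =
      cycle C1⇒C1b (agree-via-f Sequential) (singletons⇒C1 ∘ C1a⇒singletons lem code)
    , cycle (C1⇒C2b ∘ C2⇒C1) (agree-via-f FiniteBlock) (singletons⇒C2 ∘ C2a⇒singletons lem code)
    , cycle C3⇒C3b (λ c3b S T → agree-via-f (λ _ → ⊤) (λ E _ → c3b E) S T tt tt) (all⇒C3 ∘ C3a⇒all code)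
    , mk⇔ (singletons⇒C2 ∘ C1⇒singletons) C2⇒C1
    where
    C1⇒C2b : C1 → C2b
    C1⇒C2b c1 B fin = invariant-blocks⇒fE B (λ τ → finite-invariant (C1⇒singletons c1) (block B τ) (fin τ))
    C1⇒C1b : C1 → C1b
    C1⇒C1b c1 I seq = C1⇒C2b c1 I (sequential⇒finiteBlock I seq)
    C3⇒C3b : C3 → C3b
    C3⇒C3b c3 S = invariant-blocks⇒fE S (λ τ → C3⇒all c3 (block S τ))

EventuallyTrue : (ℕ → Bool) → Set
EventuallyTrue x = Σ ℕ λ N → ∀ k → x (N + k) ≡ true

eventually-agree : ∀ M {x y : ℕ → Bool} → (∀ m → M ≤ m → x m ≡ y m) → EventuallyTrue x → EventuallyTrue y
eventually-agree M {x} {y} x≗y (N , tail) = N + M , λ k → begin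
  y (N + M + k)   ≡⟨ sym (x≗y (N + M + k) (≤-trans (m≤n+m M N) (m≤m+n (N + M) k))) ⟩
  x (N + M + k)   ≡⟨ cong x (+-assoc N M k) ⟩
  x (N + (M + k)) ≡⟨ tail (M + k) ⟩
  true            ∎

does-tail : ∀ (lem : ExcludedMiddle 0ℓ) M {x y : ℕ → Bool} → (∀ m → M ≤ m → x m ≡ y m) →
            does (lem {EventuallyTrue x}) ≡ does (lem {EventuallyTrue y})
does-tail lem M x≗y =
  does-⇔ (mk⇔ (eventually-agree M x≗y) (eventually-agree M (λ m le → sym (x≗y m le)))) lem lem

module Counterexample (lem : ExcludedMiddle 0ℓ) where

  codeℕ : Countable ℕ
  codeℕ = ↣-id ℕ

  tailNetwork : (ℕ → Bool) → (ℕ → Bool)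
  tailNetwork x zero    = does (lem {EventuallyTrue x})
  tailNetwork x (suc _) = true

  tailNetwork-ext : Extensional tailNetwork
  tailNetwork-ext x y x≗y zero    = does-tail lem 0 (λ m _ → x≗y m)
  tailNetwork-ext x y x≗y (suc _) = refl

  open Network (decEq codeℕ) tailNetwork
  open Invariance (decEq codeℕ) tailNetwork tailNetwork-ext

  -- Updating one coordinate j leaves the sequence unchanged beyond j.
  singletons-invariant : ∀ j → Invariant ⁅ j ⁆
  singletons-invariant j x zero    _ = does-tail lem (suc j) beyond-j
    where
    beyond-j : ∀ m → suc j ≤ m → upd ⁅ j ⁆ x m ≡ x m
    beyond-j m j<m = upd-out ⁅ j ⁆ x m (⁅⁆-other (λ m≡j → <⇒≢ j<m (sym m≡j)))
  singletons-invariant j x (suc _) _ = refl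

  positive : Subset ℕ
  positive zero    = false
  positive (suc _) = true

  allFalse : ℕ → Bool
  allFalse _ = false

  -- Updating the positive coordinates of allFalse makes it eventually true,
  -- which changes f at 0 although 0 ∉ positive.
  not-C3 : ¬ C3
  not-C3 c3 = true≢false (begin
    true                                              ≡⟨ sym (dec-true (lem {EventuallyTrue (upd positive allFalse)})
                                                                       (1 , λ _ → refl)) ⟩
    tailNetwork (upd positive allFalse) 0             ≡⟨ C3⇒all c3 positive allFalse 0 refl ⟩
    tailNetwork allFalse 0                            ≡⟨ dec-false (lem {EventuallyTrue allFalse})
                                                                   (λ (_ , tail) → true≢false (sym (tail 0))) ⟩
    false                                             ∎)

  satisfies-C1 : C1
  satisfies-C1 = singletons⇒C1 singletons-invariant

boolAlphabet : FiniteAlphabet Bool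
boolAlphabet = 2 , ≤-refl , 2↔Bool

theorem1 : ExcludedMiddle 0ℓ →
    ((Q Z : Set) → FiniteAlphabet Q → (cZ : Countable Z) →
      (f : (Z → Q) → (Z → Q)) → Extensional f →
        let open Network (decEq cZ) f in
        ((C1 ⇔ C1a) × (C1a ⇔ C1b))
        × ((C2 ⇔ C2a) × (C2a ⇔ C2b))
        × ((C3 ⇔ C3a) × (C3a ⇔ C3b))
        × (C1 ⇔ C2))
    × (Σ Set λ Q → Σ Set λ Z → FiniteAlphabet Q × Σ (Countable Z) λ cZ →
        Σ ((Z → Q) → (Z → Q)) λ f → Extensional f
          × Network.C1 (decEq cZ) f × ¬ Network.C3 (decEq cZ) f)
theorem1 lem =
    (λ Q Z _ cZ f ext → Invariance.characterisation (decEq cZ) f ext lem cZ)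
  , (Bool , ℕ , boolAlphabet , codeℕ , tailNetwork , tailNetwork-ext , satisfies-C1 , not-C3)
  where
  open Counterexample lem
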